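{- Let $k \in \mathbb{N}$. For every set $A \subseteq \mathbb{N}$ with $\min(A) = 0$, $\max(A) \le k$ and $A \neq [k]$, we have $d(A) < d([k])$. That is, $[k] = \{0,1,\ldots,k\}$ is the unique maximum of $d(\cdot)$ on the collection $\mathcal{Z}_{\le k}$ of sets $A\subseteq\mathbb{N}$ with $\min(A)=0$ and $\max(A)\le k$.
   Context: $\mathbb{N} = \{0,1,2,\ldots\}$. For $A, B \subseteq \mathbb{N}$ the sumset is $A+B = \{a+b : a \in A, b \in B\}$. A set $B\subseteq\mathbb{N}$ is an additive divisor of a finite set $C \subseteq \mathbb{N}$ if there exists $D \subseteq \mathbb{N}$ with $C = B + D$; $d(C)$ denotes the number of additive divisors of $C$. For $k\in\mathbb{N}$, $[k] = \{0,1,\ldots,k\}$. -}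

module Defs where

open import Data.Nat using (ℕ; zero; suc; _+_; _∸_; _<?_)
open import Data.Bool using (Bool; true; false; _∧_; if_then_else_)
open import Data.Bool.Properties using () renaming (_≟_ to _≟ᵇ_)
open import Data.Vec using (Vec; []; _∷_; lookup; replicate)
open import Data.Fin using (fromℕ<)
open import Data.List using (List; []; _∷_; map; _++_; upTo)
open import Data.Bool.ListAction using (any; all)
open import Data.Nat.ListAction using (sum)
open import Relation.Nullary using (yes; no)
open import Relation.Nullary.Decidable using (⌊_⌋)

-- A finite set S ⊆ [k] = {0,…,k} is represented by its characteristic
-- vector of length k+1 (entry i is true iff i ∈ S).
SubsetOf : ℕ → Set
SubsetOf k = Vec Bool (suc k)

mem : ∀ {k} → SubsetOf k → ℕ → Bool
mem {k} S n with n <? suc k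
... | yes p = lookup S (fromℕ< p)
... | no _  = false

inSumset : ∀ {k} → SubsetOf k → SubsetOf k → ℕ → Bool
inSumset B D c = any (λ b → mem B b ∧ mem D (c ∸ b)) (upTo (suc c))

-- C = B + D.  For C, B, D ⊆ [k] all elements of C and of B + D lie in
-- [2k], so equality of the sets is checked on 0,…,2k.
sumsetEq : ∀ {k} → SubsetOf k → SubsetOf k → SubsetOf k → Bool
sumsetEq {k} C B D =
  all (λ c → ⌊ mem C c ≟ᵇ inSumset B D c ⌋) (upTo (suc (k + k)))

allVecs : (n : ℕ) → List (Vec Bool n)
allVecs zero    = [] ∷ []
allVecs (suc n) = map (true ∷_) (allVecs n) ++ map (false ∷_) (allVecs n)

-- B is an additive divisor of C: ∃ D with C = B + D.
-- (For nonempty C ⊆ [k], any such B and D are subsets of [k].)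
isAdditiveDivisor : ∀ {k} → SubsetOf k → SubsetOf k → Bool
isAdditiveDivisor {k} C B = any (λ D → sumsetEq C B D) (allVecs (suc k))

d : ∀ {k} → SubsetOf k → ℕ
d {k} C = sum (map (λ B → if isAdditiveDivisor C B then 1 else 0) (allVecs (suc k)))

interval : (k : ℕ) → SubsetOf k
interval k = replicate (suc k) true

-- Let rank x = |A ∩ [0, x)|, which maps A increasingly into [k]. If A = B + D with 0 ∈ A,
-- then 0 ∈ D, so B ⊆ A, and rank(B) is an additive divisor of [k]: with M = max B, every
-- t ∈ D satisfies t ≤ k − M, so for consecutive elements x < y of B the set A ∩ [x, y) has
-- at most k − M + 1 elements, i.e. consecutive elements of rank(B) differ by at most
-- k − rank M + 1, whence rank(B) + [k − rank M] = [k]. As rank is injective on A, B ↦ rank(B)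
-- is injective on the divisors of A; and rank(B) = [k] would force A = [k]. Since [k]
-- divides itself, d(A) < d([k]).
module Submission where

open import Defs
open import Data.Bool using (Bool; true; false; T; _∧_; if_then_else_)
open import Data.Bool.ListAction using (any)
open import Data.Bool.Properties using (T?; T-∧) renaming (_≟_ to _≟ᵇ_)
open import Data.Empty using (⊥-elim)
open import Data.Fin using (Fin; toℕ; fromℕ<)
open import Data.Fin.Properties using (toℕ<n; fromℕ<-toℕ; toℕ-fromℕ<)
open import Data.List using (List; []; _∷_; map; _++_; length; filter; upTo)
open import Data.List.Membership.Propositional using (_∈_; find; lose)
open import Data.List.Membership.Propositional.Properties
  using (∈-upTo⁺; ∈-upTo⁻; ∈-map⁺; ∈-map⁻; ∈-++⁺ˡ; ∈-++⁺ʳ; ∈-++⁻; ∈-∃++; ∈-filter⁺; ∈-filter⁻)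
open import Data.List.Properties using (length-++; length-map)
open import Data.List.Relation.Binary.Subset.Propositional using (_⊆_)
open import Data.List.Relation.Unary.All as All using (All; []; _∷_)
import Data.List.Relation.Unary.All.Properties as Allₚ
open import Data.List.Relation.Unary.AllPairs using ([]; _∷_)
open import Data.List.Relation.Unary.Any using (here; there)
open import Data.List.Relation.Unary.Any.Properties using (any⁺; any⁻)
open import Data.List.Relation.Unary.Unique.Propositional using (Unique)
import Data.List.Relation.Unary.Unique.Propositional.Properties as Unique
open import Data.Nat using (ℕ; zero; suc; _+_; _∸_; _≤_; _<_; z≤n; s≤s; _<?_; _≤?_; _≤ᵇ_; _≡ᵇ_)
open import Data.Nat.ListAction using (sum)
open import Data.Nat.Properties
open import Data.Product using (∃; _×_; _,_; proj₁; proj₂)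
open import Data.Sum using (inj₁; inj₂)
open import Data.Vec using (Vec; []; _∷_; lookup; tabulate)
open import Data.Vec.Properties
  using (∷-injectiveʳ; lookup-replicate; lookup∘tabulate; tabulate∘lookup; tabulate-cong)
open import Function using (_∘_; Equivalence)
open import Relation.Binary.Definitions using (tri<; tri≈; tri>)
open import Relation.Binary.PropositionalEquality
open import Relation.Nullary using (¬_; yes; no; contradiction)
open import Relation.Nullary.Decidable using (⌊_⌋; toWitness; fromWitness)

T-extensional : ∀ {a b} → (T a → T b) → (T b → T a) → a ≡ b
T-extensional {false} {false} _ _ = refl
T-extensional {false} {true}  _ g = ⊥-elim (g _)
T-extensional {true}  {false} f _ = ⊥-elim (f _)
T-extensional {true}  {true}  _ _ = refl

module _ (p : ℕ → Bool) where

  greatest : T (p 0) → ∀ n →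
    ∃ λ m → m ≤ n × T (p m) × (∀ {j} → j ≤ n → T (p j) → j ≤ m)
  greatest p0 zero = 0 , z≤n , p0 , λ j≤0 _ → j≤0
  greatest p0 (suc n) with p (suc n) in eq
  ... | true = suc n , ≤-refl , subst T (sym eq) _ , λ j≤n _ → j≤n
  ... | false with greatest p0 n
  ...   | m , m≤n , pm , above = m , m≤n⇒m≤1+n m≤n , pm , below
    where
    below : ∀ {j} → j ≤ suc n → T (p j) → j ≤ m
    below {j} j≤1+n pj with m≤n⇒m<n∨m≡n j≤1+n
    ... | inj₁ j<1+n = above (≤-pred j<1+n) pj
    ... | inj₂ refl  = ⊥-elim (subst T eq pj)

  leastAbove : ∀ x d → T (p (suc x + d)) →
    ∃ λ y → x < y × T (p y) × (∀ {j} → x < j → j < y → ¬ T (p j))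
  leastAbove x d pd with p (suc x) in eq
  ... | true = suc x , ≤-refl , subst T (sym eq) _ , λ x<j j<1+x _ → <⇒≱ x<j (≤-pred j<1+x)
  leastAbove x zero pd | false = ⊥-elim (subst T eq (subst (T ∘ p) (+-identityʳ (suc x)) pd))
  leastAbove x (suc d) pd | false with leastAbove (suc x) d (subst (T ∘ p) (+-suc (suc x) d) pd)
  ... | y , 1+x<y , py , none = y , <-trans (n<1+n x) 1+x<y , py , none′
    where
    none′ : ∀ {j} → x < j → j < y → ¬ T (p j)
    none′ {j} x<j j<y with m≤n⇒m<n∨m≡n x<j
    ... | inj₁ 1+x<j = none 1+x<j j<y
    ... | inj₂ refl  = subst T eq

  coveredBySteps : ∀ g N → T (p 0) →
    (∀ {x} → T (p x) → x + g < N → ∃ λ y → T (p y) × x < y × y ≤ suc (x + g)) →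
    ∀ {c} → c ≤ N → ∃ λ x → T (p x) × x ≤ c × c ≤ x + g
  coveredBySteps g N p0 step {zero} _ = 0 , p0 , z≤n , z≤n
  coveredBySteps g N p0 step {suc c} c<N
    with coveredBySteps g N p0 step (<⇒≤ c<N)
  ... | x , px , x≤c , c≤x+g with suc c ≤? x + g
  ...   | yes c<x+g = x , px , m≤n⇒m≤1+n x≤c , c<x+g
  ...   | no c≮x+g with ≤-antisym c≤x+g (≮⇒≥ c≮x+g)
  ...     | refl with step px c<N
  ...       | y , py , x<y , y≤1+c = y , py , y≤1+c , +-monoˡ-≤ g x<y

  rank : ℕ → ℕ
  rank zero    = 0
  rank (suc x) = if p x then suc (rank x) else rank x

  rank-suc-≤ : ∀ x → rank (suc x) ≤ suc (rank x)
  rank-suc-≤ x with p x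
  ... | true  = ≤-refl
  ... | false = n≤1+n (rank x)

  rank-≤-suc : ∀ x → rank x ≤ rank (suc x)
  rank-≤-suc x with p x
  ... | true  = n≤1+n (rank x)
  ... | false = ≤-refl

  rank-suc-T : ∀ {x} → T (p x) → rank (suc x) ≡ suc (rank x)
  rank-suc-T {x} px with p x
  ... | true = refl

  rank-suc-¬T : ∀ {x} → ¬ T (p x) → rank (suc x) ≡ rank x
  rank-suc-¬T {x} ¬px with p x
  ... | true  = contradiction _ ¬px
  ... | false = refl

  rank-mono : ∀ {x y} → x ≤ y → rank x ≤ rank y
  rank-mono {y = zero}  z≤n = ≤-refl
  rank-mono {y = suc y} x≤1+y with m≤n⇒m<n∨m≡n x≤1+y
  ... | inj₁ x<1+y = ≤-trans (rank-mono (≤-pred x<1+y)) (rank-≤-suc y)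
  ... | inj₂ refl  = ≤-refl

  rank-+ : ∀ x d → rank (x + d) ≤ rank x + d
  rank-+ x zero    rewrite +-identityʳ x | +-identityʳ (rank x) = ≤-refl
  rank-+ x (suc d) rewrite +-suc x d | +-suc (rank x) d =
    ≤-trans (rank-suc-≤ (x + d)) (s≤s (rank-+ x d))

  rank-≤ : ∀ x → rank x ≤ x
  rank-≤ = rank-+ 0

  rank-strict : ∀ {x y} → T (p x) → x < y → rank x < rank y
  rank-strict px x<y = subst (_≤ _) (rank-suc-T px) (rank-mono x<y)

  rank-injective : ∀ {x y} → T (p x) → T (p y) → rank x ≡ rank y → x ≡ y
  rank-injective {x} {y} px py eq with <-cmp x y
  ... | tri< x<y _ _ = contradiction eq (<⇒≢ (rank-strict px x<y))
  ... | tri≈ _ x≡y _ = x≡y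
  ... | tri> _ _ y<x = contradiction eq (≢-sym (<⇒≢ (rank-strict py y<x)))

  rank-gap : ∀ {u v} → (∀ {a} → u ≤ a → a < v → ¬ T (p a)) → rank v ≤ rank u
  rank-gap {u} {zero}  _    = z≤n
  rank-gap {u} {suc v} none with u ≤? v
  ... | yes u≤v = ≤-trans (≤-reflexive (rank-suc-¬T (none u≤v ≤-refl)))
                          (rank-gap (λ u≤a a<v → none u≤a (m≤n⇒m≤1+n a<v)))
  ... | no u≰v  = rank-mono (≰⇒> u≰v)

  rank≡⇒T : ∀ {x} → rank x ≡ x → ∀ {a} → a < x → T (p a)
  rank≡⇒T {suc x} eq {a} a<1+x with p x in px
  ... | false = contradiction eq (<⇒≢ (s≤s (rank-≤ x)))
  ... | true with m≤n⇒m<n∨m≡n a<1+x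
  ...   | inj₁ a<x = rank≡⇒T (suc-injective eq) (≤-pred a<x)
  ...   | inj₂ refl = subst T (sym px) _

module _ {X : Set} where

  Unique⇒length-mono : ∀ {xs ys : List X} → Unique xs → xs ⊆ ys → length xs ≤ length ys
  Unique⇒length-mono {[]}     _              _     = z≤n
  Unique⇒length-mono {x ∷ xs} (x∉xs ∷ xs!) xs⊆ys with ∈-∃++ (xs⊆ys (here refl))
  ... | us , vs , refl = begin
    suc (length xs)              ≤⟨ s≤s (Unique⇒length-mono xs! xs⊆us++vs) ⟩
    suc (length (us ++ vs))      ≡⟨ cong suc (length-++ us) ⟩
    suc (length us + length vs)  ≡⟨ +-suc (length us) (length vs) ⟨
    length us + length (x ∷ vs)  ≡⟨ length-++ us ⟨
    length (us ++ x ∷ vs)        ∎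
    where
    open ≤-Reasoning
    xs⊆us++vs : xs ⊆ us ++ vs
    xs⊆us++vs z∈xs with ∈-++⁻ us (xs⊆ys (there z∈xs))
    ... | inj₁ z∈us         = ∈-++⁺ˡ z∈us
    ... | inj₂ (here refl)  = contradiction refl (All.lookup x∉xs z∈xs)
    ... | inj₂ (there z∈vs) = ∈-++⁺ʳ us z∈vs

  Unique-map-injectiveOn : ∀ {P : X → Set} {f : X → X} →
    (∀ {x y} → P x → P y → f x ≡ f y → x ≡ y) →
    ∀ {xs} → All P xs → Unique xs → Unique (map f xs)
  Unique-map-injectiveOn inj []         []           = []
  Unique-map-injectiveOn inj (px ∷ pxs) (x∉xs ∷ xs!) =
    Allₚ.map⁺ (All.zipWith (λ (py , x≢y) → x≢y ∘ inj px py) (pxs , x∉xs))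
    ∷ Unique-map-injectiveOn inj pxs xs!

  indicatorSum≡length-filter : ∀ (p : X → Bool) xs →
    sum (map (λ x → if p x then 1 else 0) xs) ≡ length (filter (T? ∘ p) xs)
  indicatorSum≡length-filter p []       = refl
  indicatorSum≡length-filter p (x ∷ xs) with p x
  ... | true  = cong suc (indicatorSum≡length-filter p xs)
  ... | false = indicatorSum≡length-filter p xs

  indicatorSum-< : ∀ {xs} → Unique xs → (∀ x → x ∈ xs) →
    (p q : X → Bool) (f : X → X) →
    (∀ {x} → T (p x) → T (q (f x))) →
    (∀ {x y} → T (p x) → T (p y) → f x ≡ f y → x ≡ y) →
    ∀ {w} → T (q w) → (∀ {x} → T (p x) → f x ≢ w) →
    sum (map (λ x → if p x then 1 else 0) xs) < sum (map (λ x → if q x then 1 else 0) xs)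
  indicatorSum-< {xs} xs! complete p q f p⇒qf inj {w} qw ∉image = begin-strict
    sum (map (λ x → if p x then 1 else 0) xs)  ≡⟨ indicatorSum≡length-filter p xs ⟩
    length ps                                  ≡⟨ length-map f ps ⟨
    length (map f ps)                          <⟨ ≤-refl ⟩
    length (w ∷ map f ps)                      ≤⟨ Unique⇒length-mono w∷fps! w∷fps⊆qs ⟩
    length (filter (T? ∘ q) xs)                ≡⟨ indicatorSum≡length-filter q xs ⟨
    sum (map (λ x → if q x then 1 else 0) xs)  ∎
    where
    open ≤-Reasoning
    ps : List X
    ps = filter (T? ∘ p) xs
    all-p : All (T ∘ p) ps
    all-p = Allₚ.all-filter (T? ∘ p) xs
    w∷fps! : Unique (w ∷ map f ps)
    w∷fps! = Allₚ.map⁺ (All.map (λ px fx≡w → ∉image px (sym fx≡w)) all-p)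
             ∷ Unique-map-injectiveOn inj all-p (Unique.filter⁺ (T? ∘ p) xs!)
    w∷fps⊆qs : w ∷ map f ps ⊆ filter (T? ∘ q) xs
    w∷fps⊆qs (here refl) = ∈-filter⁺ (T? ∘ q) (complete w) qw
    w∷fps⊆qs (there fx∈fps) with ∈-map⁻ f fx∈fps
    ... | x , x∈ps , refl with ∈-filter⁻ (T? ∘ p) {xs = xs} x∈ps
    ...   | _ , px = ∈-filter⁺ (T? ∘ q) (complete (f x)) (p⇒qf px)

allVecs-complete : ∀ {n} (v : Vec Bool n) → v ∈ allVecs n
allVecs-complete []          = here refl
allVecs-complete (true ∷ v)  = ∈-++⁺ˡ (∈-map⁺ (true ∷_) (allVecs-complete v))
allVecs-complete (false ∷ v) = ∈-++⁺ʳ _ (∈-map⁺ (false ∷_) (allVecs-complete v))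

allVecs-unique : ∀ n → Unique (allVecs n)
allVecs-unique zero    = [] ∷ []
allVecs-unique (suc n) = Unique.++⁺ (Unique.map⁺ ∷-injectiveʳ (allVecs-unique n))
                                    (Unique.map⁺ ∷-injectiveʳ (allVecs-unique n))
                                    disjoint
  where
  disjoint : ∀ {v} → ¬ (v ∈ map (true ∷_) (allVecs n) × v ∈ map (false ∷_) (allVecs n))
  disjoint (v∈true∷ , v∈false∷) with ∈-map⁻ (true ∷_) v∈true∷ | ∈-map⁻ (false ∷_) v∈false∷
  ... | _ , _ , refl | _ , _ , ()

module _ {k : ℕ} where

  -- A record rather than T (mem S n), so that n and S can be inferred from a membership proof.
  infix 4 _∈ₛ_
  record _∈ₛ_ (n : ℕ) (S : SubsetOf k) : Set where
    constructor mem⁺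
    field mem⁻ : T (mem S n)

  open _∈ₛ_ public

  ∈ₛ⇒≤ : ∀ {S n} → n ∈ₛ S → n ≤ k
  ∈ₛ⇒≤ {S} {n} (mem⁺ n∈S) with n <? suc k
  ... | yes n<1+k = ≤-pred n<1+k

  mem-lookup : ∀ S (i : Fin (suc k)) → mem S (toℕ i) ≡ lookup S i
  mem-lookup S i with toℕ i <? suc k
  ... | yes i<1+k = cong (lookup S) (fromℕ<-toℕ i i<1+k)
  ... | no  i≮1+k = contradiction (toℕ<n i) i≮1+k

  mem-tabulate : ∀ (f : ℕ → Bool) {n} → n ≤ k → mem {k} (tabulate (f ∘ toℕ)) n ≡ f n
  mem-tabulate f {n} n≤k with n <? suc k
  ... | yes n<1+k = trans (lookup∘tabulate (f ∘ toℕ) (fromℕ< n<1+k)) (cong f (toℕ-fromℕ< n<1+k))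
  ... | no  n≮1+k = contradiction (s≤s n≤k) n≮1+k

  mem-interval : ∀ {n} → n ≤ k → mem (interval k) n ≡ true
  mem-interval {n} n≤k with n <? suc k
  ... | yes n<1+k = lookup-replicate (fromℕ< n<1+k) true
  ... | no  n≮1+k = contradiction (s≤s n≤k) n≮1+k

  ∈ₛ-interval : ∀ {n} → n ≤ k → n ∈ₛ interval k
  ∈ₛ-interval n≤k = mem⁺ (subst T (sym (mem-interval n≤k)) _)

  infix 4 _⊆ₛ_
  _⊆ₛ_ : SubsetOf k → SubsetOf k → Set
  S ⊆ₛ S′ = ∀ {n} → n ∈ₛ S → n ∈ₛ S′

  ⊆ₛ-antisym : ∀ {S S′} → S ⊆ₛ S′ → S′ ⊆ₛ S → S ≡ S′
  ⊆ₛ-antisym {S} {S′} S⊆S′ S′⊆S = begin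
    S                       ≡⟨ tabulate∘lookup S ⟨
    tabulate (lookup S)     ≡⟨ tabulate-cong pointwise ⟩
    tabulate (lookup S′)    ≡⟨ tabulate∘lookup S′ ⟩
    S′                      ∎
    where
    open ≡-Reasoning
    pointwise : ∀ i → lookup S i ≡ lookup S′ i
    pointwise i = begin
      lookup S i      ≡⟨ mem-lookup S i ⟨
      mem S (toℕ i)   ≡⟨ T-extensional (mem⁻ ∘ S⊆S′ {toℕ i} ∘ mem⁺)
                                   (mem⁻ ∘ S′⊆S {toℕ i} ∘ mem⁺) ⟩
      mem S′ (toℕ i)  ≡⟨ mem-lookup S′ i ⟩
      lookup S′ i     ∎

  record IsSumset (C B D : SubsetOf k) : Set where
    field
      split : ∀ {c} → c ∈ₛ C → ∃ λ b → b ≤ c × b ∈ₛ B × c ∸ b ∈ₛ D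
      add   : ∀ {b t} → b ∈ₛ B → t ∈ₛ D → b + t ∈ₛ C

  module _ {B D : SubsetOf k} where

    inSumset-intro : ∀ {b c} → b ≤ c → b ∈ₛ B → c ∸ b ∈ₛ D → T (inSumset B D c)
    inSumset-intro {c = c} b≤c b∈B c-b∈D =
      any⁺ (λ b → mem B b ∧ mem D (c ∸ b))
        (lose (∈-upTo⁺ (s≤s b≤c)) (Equivalence.from T-∧ (mem⁻ b∈B , mem⁻ c-b∈D)))

    inSumset-elim : ∀ {c} → T (inSumset B D c) → ∃ λ b → b ≤ c × b ∈ₛ B × c ∸ b ∈ₛ D
    inSumset-elim {c} h with find (any⁻ _ (upTo (suc c)) h)
    ... | b , b∈upTo , b∈B∧c-b∈D =
      let b∈B , c-b∈D = Equivalence.to T-∧ b∈B∧c-b∈D in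
      b , ≤-pred (∈-upTo⁻ b∈upTo) , mem⁺ b∈B , mem⁺ c-b∈D

  module _ {C B D : SubsetOf k} where

    IsSumset⇒sumsetEq : IsSumset C B D → T (sumsetEq C B D)
    IsSumset⇒sumsetEq C=B+D = Allₚ.all⁻ (λ c → ⌊ mem C c ≟ᵇ inSumset B D c ⌋)
      (All.tabulate {xs = upTo (suc (k + k))} λ {c} _ →
        fromWitness (T-extensional (⊆ {c} ∘ mem⁺) (mem⁻ ∘ ⊇ {c})))
      where
      open IsSumset C=B+D
      ⊆ : ∀ {c} → c ∈ₛ C → T (inSumset B D c)
      ⊆ c∈C with split c∈C
      ... | b , b≤c , b∈B , c-b∈D = inSumset-intro b≤c b∈B c-b∈D
      ⊇ : ∀ {c} → T (inSumset B D c) → c ∈ₛ C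
      ⊇ h with inSumset-elim h
      ... | b , b≤c , b∈B , c-b∈D = subst (_∈ₛ C) (m+[n∸m]≡n b≤c) (add b∈B c-b∈D)

    sumsetEq⇒IsSumset : T (sumsetEq C B D) → IsSumset C B D
    sumsetEq⇒IsSumset h = record { split = split ; add = add }
      where
      agree : ∀ {c} → c ≤ k + k → mem C c ≡ inSumset B D c
      agree c≤2k = toWitness (All.lookup (Allₚ.all⁺ _ (upTo (suc (k + k))) h) (∈-upTo⁺ (s≤s c≤2k)))
      split : ∀ {c} → c ∈ₛ C → ∃ λ b → b ≤ c × b ∈ₛ B × c ∸ b ∈ₛ D
      split c∈C = inSumset-elim (subst T (agree (≤-trans (∈ₛ⇒≤ c∈C) (m≤m+n k k))) (mem⁻ c∈C))
      add : ∀ {b t} → b ∈ₛ B → t ∈ₛ D → b + t ∈ₛ C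
      add {b} {t} b∈B t∈D =
        mem⁺ (subst T (sym (agree (+-mono-≤ (∈ₛ⇒≤ b∈B) (∈ₛ⇒≤ t∈D))))
          (inSumset-intro (m≤m+n b t) b∈B (subst (_∈ₛ D) (sym (m+n∸m≡n b t)) t∈D)))

  isAdditiveDivisor⇒IsSumset : ∀ {C B} → T (isAdditiveDivisor C B) → ∃ (IsSumset C B)
  isAdditiveDivisor⇒IsSumset {C} {B} h with find (any⁻ (sumsetEq C B) (allVecs (suc k)) h)
  ... | D , _ , C=B+D = D , sumsetEq⇒IsSumset C=B+D

  IsSumset⇒isAdditiveDivisor : ∀ {C B D} → IsSumset C B D → T (isAdditiveDivisor C B)
  IsSumset⇒isAdditiveDivisor {C} {B} {D} C=B+D =
    any⁺ (sumsetEq C B) (lose (allVecs-complete D) (IsSumset⇒sumsetEq C=B+D))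

  module _ {A B D : SubsetOf k} (A=B+D : IsSumset A B D) where
    open IsSumset A=B+D

    zero∈summands : 0 ∈ₛ A → 0 ∈ₛ B × 0 ∈ₛ D
    zero∈summands 0∈A with split 0∈A
    ... | b , b≤0 , b∈B , 0∈D with n≤0⇒n≡0 b≤0
    ...   | refl = b∈B , 0∈D

    summand⊆sumset : 0 ∈ₛ D → B ⊆ₛ A
    summand⊆sumset 0∈D {b} b∈B = subst (_∈ₛ A) (+-identityʳ b) (add b∈B 0∈D)

  initialSegment : ℕ → SubsetOf k
  initialSegment m = tabulate (λ i → toℕ i ≤ᵇ m)

  interval-isSumset : ∀ {P} m → (∀ {p} → p ∈ₛ P → p + m ≤ k) →
    (∀ {c} → c ≤ k → ∃ λ p → p ∈ₛ P × p ≤ c × c ≤ p + m) →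
    IsSumset (interval k) P (initialSegment m)
  interval-isSumset {P} m bounded covers = record { split = split ; add = add }
    where
    split : ∀ {c} → c ∈ₛ interval k → ∃ λ p → p ≤ c × p ∈ₛ P × c ∸ p ∈ₛ initialSegment m
    split {c} c∈[k] with covers (∈ₛ⇒≤ c∈[k])
    ... | p , p∈P , p≤c , c≤p+m =
      p , p≤c , p∈P , mem⁺ (subst T (sym (mem-tabulate (_≤ᵇ m) c-p≤k)) (≤⇒≤ᵇ c-p≤m))
      where
      c-p≤m : c ∸ p ≤ m
      c-p≤m = m≤n+o⇒m∸n≤o c p c≤p+m
      c-p≤k : c ∸ p ≤ k
      c-p≤k = ≤-trans (m∸n≤m c p) (∈ₛ⇒≤ c∈[k])
    add : ∀ {p t} → p ∈ₛ P → t ∈ₛ initialSegment m → p + t ∈ₛ interval k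
    add {p} {t} p∈P t∈[m] = ∈ₛ-interval (≤-trans (+-monoʳ-≤ p t≤m) (bounded p∈P))
      where
      t≤m : t ≤ m
      t≤m = ≤ᵇ⇒≤ t m (subst T (mem-tabulate (_≤ᵇ m) (∈ₛ⇒≤ t∈[m])) (mem⁻ t∈[m]))

  interval-additiveDivisor : T (isAdditiveDivisor (interval k) (interval k))
  interval-additiveDivisor = IsSumset⇒isAdditiveDivisor
    (interval-isSumset 0 (λ p∈[k] → subst (_≤ k) (sym (+-identityʳ _)) (∈ₛ⇒≤ p∈[k]))
                         (λ c≤k → _ , ∈ₛ-interval c≤k , ≤-refl , m≤m+n _ 0))

  hasPreimage : (ℕ → ℕ) → SubsetOf k → ℕ → Bool
  hasPreimage f B i = any (λ x → mem B x ∧ (f x ≡ᵇ i)) (upTo (suc k))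

  image : (ℕ → ℕ) → SubsetOf k → SubsetOf k
  image f B = tabulate (hasPreimage f B ∘ toℕ)

  module _ (f : ℕ → ℕ) {B : SubsetOf k} where

    ∈ₛ-image⁺ : ∀ {x} → x ∈ₛ B → f x ≤ k → f x ∈ₛ image f B
    ∈ₛ-image⁺ {x} x∈B fx≤k = mem⁺ (subst T (sym (mem-tabulate (hasPreimage f B) fx≤k))
      (any⁺ (λ y → mem B y ∧ (f y ≡ᵇ f x))
        (lose (∈-upTo⁺ (s≤s (∈ₛ⇒≤ x∈B)))
              (Equivalence.from T-∧ (mem⁻ x∈B , ≡⇒≡ᵇ (f x) (f x) refl)))))

    ∈ₛ-image⁻ : ∀ {i} → i ∈ₛ image f B → ∃ λ x → x ∈ₛ B × f x ≡ i
    ∈ₛ-image⁻ {i} i∈fB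
      with find (any⁻ _ (upTo (suc k))
                  (subst T (mem-tabulate (hasPreimage f B) (∈ₛ⇒≤ i∈fB)) (mem⁻ i∈fB)))
    ... | x , _ , x∈B∧fx≡i = let x∈B , fx≡i = Equivalence.to T-∧ x∈B∧fx≡i in
      x , mem⁺ x∈B , ≡ᵇ⇒≡ (f x) i fx≡i

module Compression {k : ℕ} (A : SubsetOf k) where

  rankA : ℕ → ℕ
  rankA = rank (mem A)

  compress : SubsetOf k → SubsetOf k
  compress = image rankA

  rankA≤k : ∀ {x} → x ∈ₛ A → rankA x ≤ k
  rankA≤k {x} x∈A = ≤-trans (rank-≤ (mem A) x) (∈ₛ⇒≤ x∈A)

  compress-injective : ∀ {B B′} → B ⊆ₛ A → B′ ⊆ₛ A → compress B ≡ compress B′ → B ≡ B′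
  compress-injective B⊆A B′⊆A eq =
    ⊆ₛ-antisym (transfer B⊆A B′⊆A eq) (transfer B′⊆A B⊆A (sym eq))
    where
    transfer : ∀ {S S′} → S ⊆ₛ A → S′ ⊆ₛ A → compress S ≡ compress S′ → S ⊆ₛ S′
    transfer {S} {S′} S⊆A S′⊆A eq {x} x∈S
      with ∈ₛ-image⁻ rankA (subst (rankA x ∈ₛ_) eq (∈ₛ-image⁺ rankA x∈S (rankA≤k (S⊆A x∈S))))
    ... | y , y∈S′ , rank-y≡rank-x =
      subst (_∈ₛ S′) (rank-injective (mem A) (mem⁻ (S′⊆A y∈S′)) (mem⁻ (S⊆A x∈S)) rank-y≡rank-x) y∈S′

  compress-≢-interval : A ≢ interval k → ∀ {B} → B ⊆ₛ A → compress B ≢ interval k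
  compress-≢-interval A≢[k] {B} B⊆A eq
    with ∈ₛ-image⁻ rankA (subst (k ∈ₛ_) (sym eq) (∈ₛ-interval ≤-refl))
  ... | x , x∈B , rank-x≡k = A≢[k] (⊆ₛ-antisym (∈ₛ-interval ∘ ∈ₛ⇒≤) [k]⊆A)
    where
    x≡k : x ≡ k
    x≡k = ≤-antisym (∈ₛ⇒≤ x∈B) (subst (_≤ x) rank-x≡k (rank-≤ (mem A) x))
    [k]⊆A : interval k ⊆ₛ A
    [k]⊆A {n} n∈[k] with m≤n⇒m<n∨m≡n (∈ₛ⇒≤ n∈[k])
    ... | inj₁ n<k  = mem⁺ (rank≡⇒T (mem A) (subst (λ y → rankA y ≡ k) x≡k rank-x≡k) n<k)
    ... | inj₂ refl = subst (_∈ₛ A) x≡k (B⊆A x∈B)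

  module _ {B D : SubsetOf k} (A=B+D : IsSumset A B D) where
    open IsSumset A=B+D

    -- An element of A below y is b + t with b ≤ x (no summand lies strictly between x and y)
    -- and t ≤ k ∸ M (as M + t ∈ A), so A has no element in [x + k ∸ M + 1, y).
    rankA-next-summand : ∀ {M x y} → M ∈ₛ B → x < y → (∀ {j} → x < j → j < y → ¬ j ∈ₛ B) →
      rankA y ≤ suc (rankA x + (k ∸ M))
    rankA-next-summand {M} {x} {y} M∈B x<y none = begin
      rankA y                    ≤⟨ rank-gap (mem A) (λ u≤a a<y → no-summand-in-gap u≤a a<y ∘ mem⁺) ⟩
      rankA (x + suc (k ∸ M))    ≤⟨ rank-+ (mem A) x (suc (k ∸ M)) ⟩
      rankA x + suc (k ∸ M)      ≡⟨ +-suc (rankA x) (k ∸ M) ⟩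
      suc (rankA x + (k ∸ M))    ∎
      where
      open ≤-Reasoning
      no-summand-in-gap : ∀ {a} → x + suc (k ∸ M) ≤ a → a < y → ¬ a ∈ₛ A
      no-summand-in-gap {a} u≤a a<y a∈A with split a∈A
      ... | b , b≤a , b∈B , a-b∈D = <⇒≱ (subst (_≤ a) (+-suc x (k ∸ M)) u≤a) a≤x+k-M
        where
        b≤x : b ≤ x
        b≤x with b ≤? x
        ... | yes b≤x = b≤x
        ... | no  b≰x = contradiction b∈B (none (≰⇒> b≰x) (≤-<-trans b≤a a<y))
        a-b≤k-M : a ∸ b ≤ k ∸ M
        a-b≤k-M = m+n≤o⇒m≤o∸n (a ∸ b) (subst (_≤ k) (+-comm M (a ∸ b)) (∈ₛ⇒≤ (add M∈B a-b∈D)))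
        a≤x+k-M : a ≤ x + (k ∸ M)
        a≤x+k-M = subst (_≤ x + (k ∸ M)) (m+[n∸m]≡n b≤a) (+-mono-≤ b≤x a-b≤k-M)

    compress-isSumset : 0 ∈ₛ A → ∀ {M} → M ∈ₛ B → (∀ {b} → b ∈ₛ B → b ≤ M) →
      IsSumset (interval k) (compress B) (initialSegment (k ∸ rankA M))
    compress-isSumset 0∈A {M} M∈B ≤M = interval-isSumset m bounded covers
      where
      m : ℕ
      m = k ∸ rankA M
      0∈B : 0 ∈ₛ B
      0∈B = proj₁ (zero∈summands A=B+D 0∈A)
      B⊆A : B ⊆ₛ A
      B⊆A = summand⊆sumset A=B+D (proj₂ (zero∈summands A=B+D 0∈A))
      rankM+m≡k : rankA M + m ≡ k
      rankM+m≡k = m+[n∸m]≡n (rankA≤k (B⊆A M∈B))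
      bounded : ∀ {p} → p ∈ₛ compress B → p + m ≤ k
      bounded p∈cB with ∈ₛ-image⁻ rankA p∈cB
      ... | x , x∈B , refl = subst (rankA x + m ≤_) rankM+m≡k (+-monoˡ-≤ m (rank-mono (mem A) (≤M x∈B)))
      step : ∀ {p} → T (mem (compress B) p) → p + m < k →
        ∃ λ q → T (mem (compress B) q) × p < q × q ≤ suc (p + m)
      step {p} p∈cB p+m<k with ∈ₛ-image⁻ rankA {i = p} (mem⁺ p∈cB)
      ... | x , x∈B , refl with x <? M
      ...   | no x≮M = contradiction (subst (_≤ rankA x + m) rankM+m≡k
                (+-monoˡ-≤ m (rank-mono (mem A) (≮⇒≥ x≮M)))) (<⇒≱ p+m<k)
      ...   | yes x<M
        with leastAbove (mem B) x (M ∸ suc x) (subst (T ∘ mem B) (sym (m+[n∸m]≡n x<M)) (mem⁻ M∈B))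
      ...     | y , x<y , y∈B , none =
        rankA y , mem⁻ (∈ₛ-image⁺ rankA y∈ₛB (rankA≤k (B⊆A y∈ₛB))) ,
        rank-strict (mem A) (mem⁻ (B⊆A x∈B)) x<y ,
        ≤-trans (rankA-next-summand M∈B x<y (λ x<j j<y j∈B → none x<j j<y (mem⁻ j∈B)))
                (s≤s (+-monoʳ-≤ (rankA x) (∸-monoʳ-≤ k (rank-≤ (mem A) M))))
        where
        y∈ₛB : y ∈ₛ B
        y∈ₛB = mem⁺ y∈B
      covers : ∀ {c} → c ≤ k → ∃ λ p → p ∈ₛ compress B × p ≤ c × c ≤ p + m
      covers c≤k with coveredBySteps (mem (compress B)) m k (mem⁻ (∈ₛ-image⁺ rankA 0∈B z≤n)) step c≤k
      ... | p , p∈cB , p≤c , c≤p+m = p , mem⁺ p∈cB , p≤c , c≤p+m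

  module _ (0∈A : 0 ∈ₛ A) {B : SubsetOf k} (B∣A : T (isAdditiveDivisor A B)) where

    additiveDivisor⊆ : B ⊆ₛ A
    additiveDivisor⊆ with isAdditiveDivisor⇒IsSumset B∣A
    ... | _ , A=B+D = summand⊆sumset A=B+D (proj₂ (zero∈summands A=B+D 0∈A))

    compress-additiveDivisor : T (isAdditiveDivisor (interval k) (compress B))
    compress-additiveDivisor with isAdditiveDivisor⇒IsSumset B∣A
    ... | _ , A=B+D with greatest (mem B) (mem⁻ (proj₁ (zero∈summands A=B+D 0∈A))) k
    ...   | M , _ , M∈B , maximal = IsSumset⇒isAdditiveDivisor
      (compress-isSumset A=B+D 0∈A (mem⁺ M∈B) (λ b∈B → maximal (∈ₛ⇒≤ b∈B) (mem⁻ b∈B)))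

mainTheorem1 : (k : ℕ) (A : SubsetOf k) →
    mem A 0 ≡ true → A ≢ interval k → d A < d (interval k)
mainTheorem1 k A A∋0 A≢[k] =
  indicatorSum-< (allVecs-unique (suc k)) allVecs-complete
    (isAdditiveDivisor A) (isAdditiveDivisor (interval k)) compress
    (compress-additiveDivisor 0∈A)
    (λ B∣A B′∣A → compress-injective (additiveDivisor⊆ 0∈A B∣A) (additiveDivisor⊆ 0∈A B′∣A))
    (interval-additiveDivisor {k})
    (λ B∣A → compress-≢-interval A≢[k] (additiveDivisor⊆ 0∈A B∣A))
  where
  open Compression A
  0∈A : 0 ∈ₛ A
  0∈A = mem⁺ (subst T (sym A∋0) _)
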